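{- Let $T$ be a weighted monogamous trigraph and $ab$ a switchable pair of $T$. Then: (i) if $T$ is Berge then $T_{a\rightarrow S}$, $T_{b\rightarrow S}$, $T_{a\rightarrow K}$ and $T_{b\rightarrow K}$ are Berge; (ii) $\alpha(T_{a\rightarrow S})=\alpha(T_{b\rightarrow S})=\alpha(T_{a\rightarrow K})=\alpha(T_{b\rightarrow K})=\alpha(T)$.
   Context: A trigraph $T$ consists of a finite vertex set $V(T)$ and a map $\theta:\binom{V(T)}{2}\to\{ -1,0,1\}$. Distinct $u,v$ are strongly adjacent if $\theta(uv)=1$, strongly antiadjacent if $\theta(uv)=-1$, semiadjacent (a switchable pair) if $\theta(uv)=0$; adjacent if $\theta(uv)\in\{0,1\}$, antiadjacent if $\theta(uv)\in\{ -1,0\}$. $N_T(v)$ is the set of vertices adjacent to $v$. The complement $\overline T$ has adjacency $-\theta$. A hole is an induced subtrigraph on $h_1,\dots,h_k$, $k\ge4$, with $h_i$ adjacent to $h_j$ if $|i-j|\in\{1,k-1\}$ and antiadjacent if $1<|i-j|<k-1$; it is odd if $k$ is odd; an antihole is an induced subtrigraph whose complement is a hole. $T$ is Berge if it has no odd hole and no odd antihole. $T$ is monogamous if every vertex is in at most one switchable pair. A stable set is a set of pairwise antiadjacent vertices. A weighted trigraph has a weight $w(v)\in\mathbb{Z}_{\ge0}$ on each vertex and $w(uv)\in\mathbb{Z}_{\ge0}$ on each switchable pair with $\max\{w(u),w(v)\}\le w(uv)\le w(u)+w(v)$. For a stable set $S$, $c(S)$ is the set of $v\in S$ strongly antiadjacent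 to all other vertices of $S$ and $\sigma(S)$ the set of switchable pairs inside $S$; the weight of $S$ is $\sum_{v\in c(S)}w(v)+\sum_{uv\in\sigma(S)}w(uv)$; $\alpha(T)$ is the maximum weight of a stable set. $T_{a\rightarrow S}$: replace the switchable pair $ab$ by a strong edge; add a new vertex $a'$ strongly adjacent to all of $N_T(a)\setminus\{b\}$ and strongly antiadjacent to all other vertices; keep all weights of vertices and switchable pairs of $T\setminus\{a\}$; give $a$ weight $w(a)+w(b)-w(ab)$ and $a'$ weight $w(ab)-w(b)$. $T_{b\rightarrow S}$ is defined symmetrically: $ab$ becomes a strong edge, new $b'$ strongly adjacent exactly to $N_T(b)\setminus\{a\}$, weights of $T\setminus\{b\}$ kept, $b$ gets $w(a)+w(b)-w(ab)$ and $b'$ gets $w(ab)-w(a)$. $T_{a\rightarrow K}$: $ab$ becomes a strong edge; new vertex $a'$ strongly adjacent to all of $\{a\}\cup N_T(a)\setminus\{b\}$ and strongly antiadjacent to all other vertices; weights of $T\setminus\{a\}$ kept; $a$ gets weight $w(a)$ and $a'$ gets $w(ab)-w(b)$. $T_{b\rightarrow K}$ is symmetric: new $b'$ strongly adjacent exactly to $\{b\}\cup N_T(b)\setminus\{a\}$, $b$ gets $w(b)$, $b'$ gets $w(ab)-w(a)$. -}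

module Defs where

open import Data.Nat using (ℕ; zero; suc; _+_; _∸_; _≤_; _<_; _⊔_; _%_)
open import Data.Bool using (Bool; true; false; _∧_; _∨_; not; if_then_else_)
open import Data.Fin using (Fin; zero; suc; toℕ)
open import Data.Fin.Properties using () renaming (_≟_ to _≟F_)
open import Data.List using (List; []; _∷_; _++_; map; foldr)
open import Data.Product using (_×_)
open import Data.Sum using (_⊎_)
open import Data.Empty using (⊥)
open import Function.Definitions using (Injective)
open import Relation.Binary.PropositionalEquality using (_≡_; _≢_)
open import Relation.Nullary using (¬_)
open import Relation.Nullary.Decidable using (⌊_⌋)

-- θ-values: strong = 1, semi = 0 (switchable pair), anti = -1
data Adj : Set where
  strong semi anti : Adj

-- A (weighted) trigraph on vertex set Fin n.  θ is read only on pairs of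
-- distinct vertices (diagonal values are irrelevant); w is the vertex weight
-- and wp u v the weight of the switchable pair uv (only read on switchable pairs).
record Trigraph (n : ℕ) : Set where
  field
    θ  : Fin n → Fin n → Adj
    w  : Fin n → ℕ
    wp : Fin n → Fin n → ℕ
open Trigraph public

WeightedTrigraph : ∀ {n} → Trigraph n → Set
WeightedTrigraph T =
  (∀ u v → θ T u v ≡ θ T v u) ×
  (∀ u v → wp T u v ≡ wp T v u) ×
  (∀ u v → u ≢ v → θ T u v ≡ semi →
     (w T u ⊔ w T v ≤ wp T u v) × (wp T u v ≤ w T u + w T v))

Monogamous : ∀ {n} → Trigraph n → Set
Monogamous T = ∀ v u u′ → u ≢ v → u′ ≢ v →
  θ T v u ≡ semi → θ T v u′ ≡ semi → u ≡ u′

Adjacent : ∀ {n} → (Fin n → Fin n → Adj) → Fin n → Fin n → Set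
Adjacent θ u v = θ u v ≢ anti

Antiadjacent : ∀ {n} → (Fin n → Fin n → Adj) → Fin n → Fin n → Set
Antiadjacent θ u v = θ u v ≢ strong

negA : Adj → Adj
negA strong = anti
negA semi   = semi
negA anti   = strong

complement : ∀ {n} → (Fin n → Fin n → Adj) → (Fin n → Fin n → Adj)
complement θ u v = negA (θ u v)

-- h : Fin k → Fin n is a hole h_0,…,h_{k-1} (indices shifted by one)
IsHole : ∀ {n} → (Fin n → Fin n → Adj) → (k : ℕ) → (Fin k → Fin n) → Set
IsHole θ k h =
  4 ≤ k × Injective _≡_ _≡_ h ×
  (∀ i j → toℕ i < toℕ j →
     (toℕ j ∸ toℕ i ≡ 1 ⊎ toℕ j ∸ toℕ i ≡ k ∸ 1) → Adjacent θ (h i) (h j)) ×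
  (∀ i j → toℕ i < toℕ j →
     1 < toℕ j ∸ toℕ i → toℕ j ∸ toℕ i < k ∸ 1 → Antiadjacent θ (h i) (h j))

IsAntihole : ∀ {n} → (Fin n → Fin n → Adj) → (k : ℕ) → (Fin k → Fin n) → Set
IsAntihole θ k h = IsHole (complement θ) k h

Berge : ∀ {n} → Trigraph n → Set
Berge T = ∀ k (h : Fin _ → _) → k % 2 ≡ 1 →
  ¬ IsHole (θ T) k h × ¬ IsAntihole (θ T) k h

_==F_ : ∀ {n} → Fin n → Fin n → Bool
u ==F v = ⌊ u ≟F v ⌋

isStrong isSemi isAnti : Adj → Bool
isStrong strong = true
isStrong _      = false
isSemi semi = true
isSemi _    = false
isAnti anti = true
isAnti _    = false

sumF : ∀ n → (Fin n → ℕ) → ℕ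
sumF zero    f = 0
sumF (suc n) f = f zero + sumF n (λ i → f (suc i))

allF : ∀ n → (Fin n → Bool) → Bool
allF zero    f = true
allF (suc n) f = f zero ∧ allF n (λ i → f (suc i))

Subset : ℕ → Set
Subset n = Fin n → Bool

stable : ∀ {n} → Trigraph n → Subset n → Bool
stable {n} T S = allF n λ u → allF n λ v →
  not (S u ∧ S v ∧ not (u ==F v) ∧ isStrong (θ T u v))

inCore : ∀ {n} → Trigraph n → Subset n → Fin n → Bool
inCore {n} T S v = S v ∧ (allF n λ u →
  not (S u ∧ not (u ==F v) ∧ not (isAnti (θ T u v))))

-- weight of S: Σ_{v∈c(S)} w(v) + Σ_{uv∈σ(S)} w(uv)  (each pair counted once, u<v)
weight : ∀ {n} → Trigraph n → Subset n → ℕ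
weight {n} T S =
  sumF n (λ v → if inCore T S v then w T v else 0) +
  sumF n (λ u → sumF n λ v →
    if S u ∧ S v ∧ ⌊ Data.Nat._<?_ (toℕ u) (toℕ v) ⌋ ∧ isSemi (θ T u v)
    then wp T u v else 0)

allSubsets : ∀ n → List (Subset n)
allSubsets zero    = (λ ()) ∷ []
allSubsets (suc n) =
  map (λ S i → ext false S i) (allSubsets n) ++ map (λ S i → ext true S i) (allSubsets n)
  where
  ext : Bool → Subset n → Subset (suc n)
  ext b S zero    = b
  ext b S (suc i) = S i

α : ∀ {n} → Trigraph n → ℕ
α T = foldr _⊔_ 0 (map (λ S → if stable T S then weight T S else 0) (allSubsets _))

-- the four operations.  New vertex a′ is `zero`; old vertex v is `suc v`.
-- T_{b→S} = toS T b a and T_{b→K} = toK T b a (the definitions are symmetric).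

module _ {n : ℕ} (T : Trigraph n) (a b : Fin n) where
  isAB : Fin n → Fin n → Bool
  isAB u v = (u ==F a ∧ v ==F b) ∨ (u ==F b ∧ v ==F a)

  inNa : Fin n → Bool
  inNa v = not (v ==F a) ∧ not (v ==F b) ∧ not (isAnti (θ T a v))

  mkθ : (Fin n → Bool) → Fin (suc n) → Fin (suc n) → Adj
  mkθ N zero    zero    = anti
  mkθ N zero    (suc v) = if N v then strong else anti
  mkθ N (suc u) zero    = if N u then strong else anti
  mkθ N (suc u) (suc v) = if isAB u v then strong else θ T u v

  mkwp : Fin (suc n) → Fin (suc n) → ℕ
  mkwp (suc u) (suc v) = wp T u v
  mkwp _       _       = 0

  toS : Trigraph (suc n)
  toS = record
    { θ  = mkθ inNa
    ; w  = λ { zero → wp T a b ∸ w T b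
             ; (suc v) → if v ==F a then w T a + w T b ∸ wp T a b else w T v }
    ; wp = mkwp }

  toK : Trigraph (suc n)
  toK = record
    { θ  = mkθ (λ v → v ==F a ∨ inNa v)
    ; w  = λ { zero → wp T a b ∸ w T b
             ; (suc v) → w T v }
    ; wp = mkwp }

module Submission where

open import Defs
open import Data.Nat using (ℕ; zero; suc; _+_; _∸_; _≤_; _<_; _⊔_; _%_; z≤n; s≤s; s≤s⁻¹; s<s; s<s⁻¹)
open import Data.Nat.Properties hiding (suc-injective)
open import Data.Nat.DivMod
  using (m%n<n; %-distribˡ-+; m%n%n≡m%n; [m+n]%n≡m%n; m<n⇒m%n≡m; m≤n⇒[n∸m]%m≡n%m; n%n≡0)
open import Data.Nat.Tactic.RingSolver using (solve-∀)
open import Algebra.Properties.CommutativeSemigroup +-commutativeSemigroup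
  using () renaming (interchange to +-interchange)
open import Data.Bool using (Bool; true; false; _∧_; _∨_; not; if_then_else_)
open import Data.Bool.Properties using (∧-comm; ∨-comm; ∧-zeroʳ; ∧-identityʳ; ∨-zeroʳ; ∨-identityʳ)
open import Data.Fin using (Fin; zero; suc; toℕ; fromℕ<)
open import Data.Fin.Properties
  using (any?; suc-injective; toℕ-injective; toℕ-fromℕ<; fromℕ<-cong; fromℕ<-toℕ; toℕ<n)
  renaming (_≟_ to _≟F_)
open import Data.List using ([]; _∷_; foldr)
open import Data.List.Membership.Propositional using (_∈_)
open import Data.List.Membership.Propositional.Properties using (∈-map⁺; ∈-map⁻; ∈-++⁺ˡ; ∈-++⁺ʳ)
open import Data.List.Relation.Unary.Any using (here; there)
open import Data.Product using (_×_; _,_; proj₁; proj₂; Σ)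
open import Data.Sum using (_⊎_; inj₁; inj₂)
open import Data.Empty using (⊥; ⊥-elim)
open import Function using (_∘_)
open import Function.Definitions using (Injective)
open import Relation.Binary using (tri<; tri≈; tri>)
open import Relation.Binary.PropositionalEquality
open import Relation.Nullary using (¬_; Dec; yes; no; contradiction)
open import Relation.Nullary.Decidable using (⌊_⌋; isYes≗does; dec-true; dec-false)

-- All four are instances of one construction (module Split): ab becomes a strong edge and a
-- new vertex a′ is added whose neighbours other than a are exactly those of a except b; the
-- operations differ only in whether a′ sees a (K) or not (S) and in the weights of a and a′.
-- The projection φ : a′ ↦ a, v ↦ v preserves every adjacency except at the pairs a′a and ab.
--
-- (i) An odd hole or antihole of the new trigraph that misses a or a′ is mapped by φ onto an
-- odd hole or antihole of T (hole-transfer).  One that contains both is impossible: a′ is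
-- dominated by a (every other neighbour of a′ is a strong neighbour of a), in the complement a
-- is dominated by a′, and an odd hole never contains a dominated pair (module CyclicHole).
--
-- (ii) φ maps the stable sets of the new trigraph onto stable sets of T, and each stable set
-- of T lifts back by dropping a when b is present and adding a′ suitably.  Corresponding
-- stable sets have the same weight away from a, b, a′ (module SplitWeights), so α is preserved
-- once the few local weights compare correctly (module LocalWeights).

module _ {n : ℕ} where

  ==F-refl : (u : Fin n) → u ==F u ≡ true
  ==F-refl u = trans (isYes≗does (u ≟F u)) (dec-true (u ≟F u) refl)

  ==F-≢ : {u v : Fin n} → u ≢ v → u ==F v ≡ false
  ==F-≢ {u} {v} u≢v = trans (isYes≗does (u ≟F v)) (dec-false (u ≟F v) u≢v)

  ==F-≡ : {u v : Fin n} → u ==F v ≡ true → u ≡ v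
  ==F-≡ {u} {v} e with u ≟F v
  ... | yes u≡v = u≡v
  ... | no _    = contradiction e λ ()

≡-by-truth : ∀ {x y : Bool} → (x ≡ true → y ≡ true) → (y ≡ true → x ≡ true) → x ≡ y
≡-by-truth {false} {false} _ _ = refl
≡-by-truth {false} {true}  _ g = g refl
≡-by-truth {true}  {false} f _ = sym (f refl)
≡-by-truth {true}  {true}  _ _ = refl

sumF-cong : ∀ n {f g : Fin n → ℕ} → (∀ i → f i ≡ g i) → sumF n f ≡ sumF n g
sumF-cong zero    e = refl
sumF-cong (suc n) e = cong₂ _+_ (e zero) (sumF-cong n (λ i → e (suc i)))

sumF-+ : ∀ n (f g : Fin n → ℕ) → sumF n (λ i → f i + g i) ≡ sumF n f + sumF n g
sumF-+ zero    f g = refl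
sumF-+ (suc n) f g = begin
  f zero + g zero + sumF n (λ i → f (suc i) + g (suc i))
    ≡⟨ cong (f zero + g zero +_) (sumF-+ n (λ i → f (suc i)) (λ i → g (suc i))) ⟩
  f zero + g zero + (sumF n (λ i → f (suc i)) + sumF n (λ i → g (suc i)))
    ≡⟨ +-interchange (f zero) (g zero) _ _ ⟩
  f zero + sumF n (λ i → f (suc i)) + (g zero + sumF n (λ i → g (suc i))) ∎
  where open ≡-Reasoning

sumF-zero : ∀ n {f : Fin n → ℕ} → (∀ i → f i ≡ 0) → sumF n f ≡ 0
sumF-zero zero    e = refl
sumF-zero (suc n) e = cong₂ _+_ (e zero) (sumF-zero n (λ i → e (suc i)))

sumF-point : ∀ n {f : Fin n → ℕ} (d : Fin n) → (∀ i → i ≢ d → f i ≡ 0) → sumF n f ≡ f d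
sumF-point (suc n) {f} zero    e =
  trans (cong (f zero +_) (sumF-zero n (λ i → e (suc i) λ ()))) (+-identityʳ _)
sumF-point (suc n) {f} (suc d) e =
  cong₂ _+_ (e zero λ ()) (sumF-point n d (λ i i≢d → e (suc i) (λ p → i≢d (suc-injective p))))

allF-elim : ∀ n {f : Fin n → Bool} → allF n f ≡ true → ∀ i → f i ≡ true
allF-elim (suc n) {f} e i with f zero in f₀
allF-elim (suc n) {f} e zero    | true = f₀
allF-elim (suc n) {f} e (suc i) | true = allF-elim n e i

allF-intro : ∀ n {f : Fin n → Bool} → (∀ i → f i ≡ true) → allF n f ≡ true
allF-intro zero    _ = refl
allF-intro (suc n) e rewrite e zero = allF-intro n (λ i → e (suc i))

allF-cong : ∀ n {f g : Fin n → Bool} → (∀ i → f i ≡ g i) → allF n f ≡ allF n g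
allF-cong zero    _ = refl
allF-cong (suc n) e = cong₂ _∧_ (e zero) (allF-cong n (λ i → e (suc i)))

_·_ : Bool → ℕ → ℕ
c · x = if c then x else 0
infix 8 _·_

·-zero : ∀ c → c · 0 ≡ 0
·-zero false = refl
·-zero true  = refl

sumF-split₂ : ∀ n {a b : Fin n} → a ≢ b → (f : Fin n → ℕ) →
  sumF n f ≡ f a + f b + sumF n (λ v → not (v ==F a ∨ v ==F b) · f v)
sumF-split₂ n {a} {b} a≢b f = begin
  sumF n f
    ≡⟨ sumF-cong n (λ v → pieces v (v ≟F a) (v ≟F b)) ⟩
  sumF n (λ v → (v ==F a) · f a + (v ==F b) · f b + not (v ==F a ∨ v ==F b) · f v)
    ≡⟨ sumF-+ n _ _ ⟩
  sumF n (λ v → (v ==F a) · f a + (v ==F b) · f b) + rest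
    ≡⟨ cong (_+ rest) (sumF-+ n _ _) ⟩
  sumF n (λ v → (v ==F a) · f a) + sumF n (λ v → (v ==F b) · f b) + rest
    ≡⟨ cong (_+ rest) (cong₂ _+_ (point a) (point b)) ⟩
  f a + f b + rest ∎
  where
  open ≡-Reasoning
  rest : ℕ
  rest = sumF n (λ v → not (v ==F a ∨ v ==F b) · f v)
  point : ∀ c → sumF n (λ v → (v ==F c) · f c) ≡ f c
  point c = trans (sumF-point n c λ v v≢c → cong (_· f c) (==F-≢ v≢c))
                  (cong (_· f c) (==F-refl c))
  pieces : ∀ v → Dec (v ≡ a) → Dec (v ≡ b) →
    f v ≡ (v ==F a) · f a + (v ==F b) · f b + not (v ==F a ∨ v ==F b) · f v
  pieces v (yes refl) _ rewrite ==F-refl v | ==F-≢ a≢b = sym (trans (+-identityʳ _) (+-identityʳ _))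
  pieces v (no v≢a) (yes refl) rewrite ==F-≢ v≢a | ==F-refl v = sym (+-identityʳ _)
  pieces v (no v≢a) (no v≢b) rewrite ==F-≢ v≢a | ==F-≢ v≢b = refl

<?-suc : ∀ x y → ⌊ suc x <? suc y ⌋ ≡ ⌊ x <? y ⌋
<?-suc x y with suc x <? suc y | x <? y
... | yes _ | yes _ = refl
... | no _  | no _  = refl
... | yes p | no ¬q = contradiction (s<s⁻¹ p) ¬q
... | no ¬p | yes q = contradiction (s<s q) ¬p

<?-irrefl : ∀ x → ⌊ x <? x ⌋ ≡ false
<?-irrefl x = trans (isYes≗does (x <? x)) (dec-false (x <? x) (<-irrefl refl))

<?-connex : ∀ {n} {u v : Fin n} → u ≢ v →
  (⌊ toℕ u <? toℕ v ⌋ ≡ true × ⌊ toℕ v <? toℕ u ⌋ ≡ false) ⊎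
  (⌊ toℕ u <? toℕ v ⌋ ≡ false × ⌊ toℕ v <? toℕ u ⌋ ≡ true)
<?-connex {u = u} {v} u≢v with toℕ u <? toℕ v | toℕ v <? toℕ u
... | yes _  | no _   = inj₁ (refl , refl)
... | no _   | yes _  = inj₂ (refl , refl)
... | yes p  | yes q  = contradiction q (<-asym p)
... | no ¬p  | no ¬q  = contradiction (toℕ-injective (≤-antisym (≮⇒≥ ¬q) (≮⇒≥ ¬p))) u≢v

isSemi-false : ∀ {t} → t ≢ semi → isSemi t ≡ false
isSemi-false {strong} _ = refl
isSemi-false {semi}   s = contradiction refl s
isSemi-false {anti}   _ = refl

vanishing : ∀ x y {c m} → c ≡ false → (x ∧ y ∧ c) · m ≡ 0
vanishing false _     _    = refl
vanishing true  false _    = refl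
vanishing true  true  refl = refl

Dominates : ∀ {m} → (Fin m → Fin m → Adj) → Fin m → Fin m → Set
Dominates θ X Y = ∀ v → v ≢ X → v ≢ Y → Adjacent θ Y v → θ X v ≡ strong

-- A hole h₀ … h_{K-1} read cyclically: position x ∈ ℕ denotes h (x mod K).
module CyclicHole {m : ℕ} (θ : Fin m → Fin m → Adj) (θ-sym : ∀ u v → θ u v ≡ θ v u)
                  (k : ℕ) (h : Fin (suc k) → Fin m) (hole : IsHole θ (suc k) h) where

  K : ℕ
  K = suc k

  4≤K : 4 ≤ K
  4≤K = proj₁ hole

  -- positions modulo K; a record so that both positions stay inferable
  record _≈_ (x y : ℕ) : Set where
    constructor mk≈
    field ≈-mod : x % K ≡ y % K
  open _≈_
  infix 4 _≈_

  ≈-sym : ∀ {x y} → x ≈ y → y ≈ x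
  ≈-sym (mk≈ e) = mk≈ (sym e)

  _⟨≈⟩_ : ∀ {x y z} → x ≈ y → y ≈ z → x ≈ z
  mk≈ e ⟨≈⟩ mk≈ e′ = mk≈ (trans e e′)
  infixr 5 _⟨≈⟩_

  +-mod : ∀ c x → (c + x) % K ≡ (c + x % K) % K
  +-mod c x = begin
    (c + x) % K              ≡⟨ %-distribˡ-+ c x K ⟩
    (c % K + x % K) % K      ≡⟨ cong (λ t → (c % K + t) % K) (sym (m%n%n≡m%n x K)) ⟩
    (c % K + x % K % K) % K  ≡⟨ sym (%-distribˡ-+ c (x % K) K) ⟩
    (c + x % K) % K          ∎
    where open ≡-Reasoning

  +-cong-≈ : ∀ c {x y} → x ≈ y → c + x ≈ c + y
  +-cong-≈ c {x} {y} (mk≈ e) =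
    mk≈ (trans (+-mod c x) (trans (cong (λ t → (c + t) % K) e) (sym (+-mod c y))))

  predecessor : ∀ y → suc (k + y) ≈ y
  predecessor y = mk≈ (trans (cong (_% K) (+-comm K y)) ([m+n]%n≡m%n y K))

  no-short-return : ∀ c x → 0 < c → c < K → ¬ (c + x ≈ x)
  no-short-return c x 0<c c<K (mk≈ e) = impossible (c + r <? K)
    where
    r : ℕ
    r = x % K
    [c+r]%K≡r : (c + r) % K ≡ r
    [c+r]%K≡r = trans (sym (+-mod c x)) e
    impossible : Dec (c + r < K) → ⊥
    impossible (yes c+r<K) =
      <⇒≢ 0<c (sym (+-cancelʳ-≡ r c 0 (trans (sym (m<n⇒m%n≡m c+r<K)) [c+r]%K≡r)))
    impossible (no c+r≮K) = <⇒≢ c<K (+-cancelʳ-≡ r c K c+r≡K+r)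
      where
      K≤c+r : K ≤ c + r
      K≤c+r = ≮⇒≥ c+r≮K
      d<K : c + r ∸ K < K
      d<K = +-cancelʳ-< K (c + r ∸ K) K
              (subst (_< K + K) (sym (m∸n+n≡m K≤c+r)) (+-mono-< c<K (m%n<n x K)))
      d≡r : c + r ∸ K ≡ r
      d≡r = trans (sym (m<n⇒m%n≡m d<K)) (trans (m≤n⇒[n∸m]%m≡n%m K≤c+r) [c+r]%K≡r)
      c+r≡K+r : c + r ≡ K + r
      c+r≡K+r = trans (sym (m∸n+n≡m K≤c+r)) (trans (cong (_+ K) d≡r) (+-comm r K))

  pos : ℕ → Fin K
  pos x = fromℕ< (m%n<n x K)

  at : ℕ → Fin m
  at x = h (pos x)

  toℕ-pos : ∀ x → toℕ (pos x) ≡ x % K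
  toℕ-pos x = toℕ-fromℕ< (m%n<n x K)

  at-toℕ : ∀ i → at (toℕ i) ≡ h i
  at-toℕ i = cong h (trans (fromℕ<-cong _ _ (m<n⇒m%n≡m (toℕ<n i)) (m%n<n (toℕ i) K) (toℕ<n i))
                           (fromℕ<-toℕ i (toℕ<n i)))

  at-cong : ∀ {x y} → x ≈ y → at x ≡ at y
  at-cong {x} {y} (mk≈ e) = cong h (fromℕ<-cong _ _ e (m%n<n x K) (m%n<n y K))

  at-injective : ∀ {x y} → at x ≡ at y → x ≈ y
  at-injective {x} {y} e =
    mk≈ (trans (sym (toℕ-pos x)) (trans (cong toℕ (proj₁ (proj₂ hole) e)) (toℕ-pos y)))

  adjacent-at : ∀ x y → x % K < y % K → (y % K ∸ x % K ≡ 1 ⊎ y % K ∸ x % K ≡ k) →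
    Adjacent θ (at x) (at y)
  adjacent-at x y lt d = proj₁ (proj₂ (proj₂ hole)) (pos x) (pos y)
    (subst₂ _<_ (sym (toℕ-pos x)) (sym (toℕ-pos y)) lt)
    (subst₂ (λ r s → s ∸ r ≡ 1 ⊎ s ∸ r ≡ k) (sym (toℕ-pos x)) (sym (toℕ-pos y)) d)

  antiadjacent-at : ∀ x y → x % K < y % K → 1 < y % K ∸ x % K → y % K ∸ x % K < k →
    Antiadjacent θ (at x) (at y)
  antiadjacent-at x y lt d₁ d₂ = proj₂ (proj₂ (proj₂ hole)) (pos x) (pos y)
    (subst₂ _<_ (sym (toℕ-pos x)) (sym (toℕ-pos y)) lt)
    (subst₂ (λ r s → 1 < s ∸ r) (sym (toℕ-pos x)) (sym (toℕ-pos y)) d₁)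
    (subst₂ (λ r s → s ∸ r < k) (sym (toℕ-pos x)) (sym (toℕ-pos y)) d₂)

  flip-adjacent : ∀ {u v} → Adjacent θ u v → Adjacent θ v u
  flip-adjacent {u} {v} ad e = ad (trans (θ-sym u v) e)

  flip-antiadjacent : ∀ {u v} → Antiadjacent θ u v → Antiadjacent θ v u
  flip-antiadjacent {u} {v} an e = an (trans (θ-sym u v) e)

  consecutive-adjacent : ∀ x y → suc x ≈ y → Adjacent θ (at x) (at y)
  consecutive-adjacent x y (mk≈ e) with m≤n⇒m<n∨m≡n (s≤s⁻¹ (m%n<n x K))
  ... | inj₁ r<k = adjacent-at x y (subst (x % K <_) 1+r≡s ≤-refl)
                     (inj₁ (trans (cong (_∸ x % K) (sym 1+r≡s)) (m+n∸n≡m 1 (x % K))))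
    where
    1+r≡s : suc (x % K) ≡ y % K
    1+r≡s = trans (sym (m<n⇒m%n≡m (s≤s r<k))) (trans (sym (+-mod 1 x)) e)
  ... | inj₂ r≡k = flip-adjacent (adjacent-at y x (subst₂ _<_ (sym s≡0) (sym r≡k) 0<k)
                                   (inj₂ (cong₂ _∸_ r≡k s≡0)))
    where
    0<k : 0 < k
    0<k = s≤s⁻¹ (≤-trans (s≤s (s≤s z≤n)) 4≤K)
    s≡0 : y % K ≡ 0
    s≡0 = trans (sym e) (trans (+-mod 1 x) (trans (cong (λ t → suc t % K) r≡k) (n%n≡0 K)))

  ordered-far-antiadjacent : ∀ x y → x % K < y % K → ¬ suc x ≈ y → ¬ suc y ≈ x →
    Antiadjacent θ (at x) (at y)
  ordered-far-antiadjacent x y r<s n₁ n₂ = antiadjacent-at x y r<s 1<s∸r s∸r<k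
    where
    r s : ℕ
    r = x % K
    s = y % K
    s≤k : s ≤ k
    s≤k = s≤s⁻¹ (m%n<n y K)
    1<s∸r : 1 < s ∸ r
    1<s∸r = ≤∧≢⇒< (m<n⇒0<n∸m r<s) λ s∸r≡1 →
      let 1+r≡s : suc r ≡ s
          1+r≡s = trans (cong (_+ r) s∸r≡1) (m∸n+n≡m (<⇒≤ r<s))
      in n₁ (mk≈ (trans (+-mod 1 x) (trans (cong (_% K) 1+r≡s) (m<n⇒m%n≡m (m%n<n y K)))))
    s∸r<k : s ∸ r < k
    s∸r<k = ≤∧≢⇒< (≤-trans (m∸n≤m s r) s≤k) λ s∸r≡k →
      let s≡k : s ≡ k
          s≡k = ≤-antisym s≤k (subst (_≤ s) s∸r≡k (m∸n≤m s r))
          r≡0 : r ≡ 0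
          r≡0 = +-cancelˡ-≡ k r 0 (trans (cong (_+ r) (sym s∸r≡k))
                  (trans (m∸n+n≡m (<⇒≤ r<s)) (trans s≡k (sym (+-identityʳ k)))))
      in n₂ (mk≈ (trans (+-mod 1 y) (trans (cong (λ t → suc t % K) s≡k)
                   (trans (n%n≡0 K) (sym r≡0)))))

  far-antiadjacent : ∀ x y → ¬ x ≈ y → ¬ suc x ≈ y → ¬ suc y ≈ x →
    Antiadjacent θ (at x) (at y)
  far-antiadjacent x y x≉y n₁ n₂ with <-cmp (x % K) (y % K)
  ... | tri< lt _ _ = ordered-far-antiadjacent x y lt n₁ n₂
  ... | tri≈ _ eq _ = contradiction (mk≈ eq) x≉y
  ... | tri> _ _ gt = flip-antiadjacent (ordered-far-antiadjacent y x gt n₂ n₁)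

  strong-consecutive : ∀ x y → ¬ x ≈ y → θ (at x) (at y) ≡ strong → suc x ≈ y ⊎ suc y ≈ x
  strong-consecutive x y x≉y st with (suc x) % K ≟ y % K | (suc y) % K ≟ x % K
  ... | yes e | _     = inj₁ (mk≈ e)
  ... | no _  | yes e = inj₂ (mk≈ e)
  ... | no n₁ | no n₂ =
    ⊥-elim (far-antiadjacent x y x≉y (λ e → n₁ (≈-mod e)) (λ e → n₂ (≈-mod e)) st)

  ≉+1 : ∀ x → ¬ (1 + x ≈ x)
  ≉+1 x = no-short-return 1 x (s≤s z≤n) (≤-trans (s≤s (s≤s z≤n)) 4≤K)

  ≉+2 : ∀ x → ¬ (2 + x ≈ x)
  ≉+2 x = no-short-return 2 x (s≤s z≤n) (≤-trans (s≤s (s≤s (s≤s z≤n))) 4≤K)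

  ≉+3 : ∀ x → ¬ (3 + x ≈ x)
  ≉+3 x = no-short-return 3 x (s≤s z≤n) 4≤K

  dominated-neighbour : ∀ x y → Dominates θ (at x) (at y) →
    ∀ p → Adjacent θ (at y) (at p) → ¬ p ≈ x → ¬ p ≈ y → suc x ≈ p ⊎ suc p ≈ x
  dominated-neighbour x y dom p ad p≉x p≉y =
    strong-consecutive x p (λ e → p≉x (≈-sym e))
      (dom (at p) (λ e → p≉x (at-injective e)) (λ e → p≉y (at-injective e)) ad)

  next-adjacent : ∀ y → Adjacent θ (at y) (at (suc y))
  next-adjacent y = consecutive-adjacent y (suc y) (mk≈ refl)

  prev-adjacent : ∀ y → Adjacent θ (at y) (at (k + y))
  prev-adjacent y = flip-adjacent (consecutive-adjacent (k + y) y (predecessor y))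

  dominated-edge : ∀ x y → ¬ x ≈ y → θ (at x) (at y) ≡ strong → ¬ Dominates θ (at x) (at y)
  dominated-edge x y x≉y st dom with strong-consecutive x y x≉y st
  ... | inj₁ x+1≈y with dominated-neighbour x y dom (suc y) (next-adjacent y)
                          (λ e → ≉+2 x (+-cong-≈ 1 x+1≈y ⟨≈⟩ e)) (≉+1 y)
  ...   | inj₁ e = ≉+1 y (≈-sym (≈-sym x+1≈y ⟨≈⟩ e))
  ...   | inj₂ e = ≉+3 x (+-cong-≈ 2 x+1≈y ⟨≈⟩ e)
  dominated-edge x y x≉y st dom | inj₂ y+1≈x
    with dominated-neighbour x y dom (k + y) (prev-adjacent y)
           (λ e → ≉+2 (k + y) (+-cong-≈ 1 (predecessor y) ⟨≈⟩ y+1≈x ⟨≈⟩ ≈-sym e))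
           (λ e → ≉+1 (k + y) (predecessor y ⟨≈⟩ ≈-sym e))
  ...   | inj₁ e = ≉+3 (k + y) (+-cong-≈ 2 (predecessor y) ⟨≈⟩ +-cong-≈ 1 y+1≈x ⟨≈⟩ e)
  ...   | inj₂ e = x≉y (≈-sym (≈-sym (predecessor y) ⟨≈⟩ e))

  dominated-nonedge : 5 ≤ K → ∀ x y → ¬ x ≈ y → θ (at x) (at y) ≡ anti →
    ¬ Dominates θ (at x) (at y)
  dominated-nonedge 5≤K x y x≉y an dom
    with dominated-neighbour x y dom (k + y) (prev-adjacent y)
           (λ e → x+1≉y (≈-sym (+-cong-≈ 1 e) ⟨≈⟩ predecessor y))
           (λ e → ≉+1 (k + y) (predecessor y ⟨≈⟩ ≈-sym e))
       | dominated-neighbour x y dom (suc y) (next-adjacent y) y+1≉x (≉+1 y)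
    where
    x+1≉y : ¬ suc x ≈ y
    x+1≉y e = consecutive-adjacent x y e an
    y+1≉x : ¬ suc y ≈ x
    y+1≉x e = flip-adjacent (consecutive-adjacent y x e) an
  ... | inj₂ e′ | _      = x≉y (≈-sym (≈-sym (predecessor y) ⟨≈⟩ e′))
  ... | inj₁ e′ | inj₁ e = ≉+2 (k + y) (+-cong-≈ 1 (predecessor y) ⟨≈⟩ ≈-sym e ⟨≈⟩ e′)
  ... | inj₁ e′ | inj₂ e = no-short-return 4 (k + y) (s≤s z≤n) 5≤K
                             (+-cong-≈ 3 (predecessor y) ⟨≈⟩ +-cong-≈ 1 e ⟨≈⟩ e′)

  private
    distinct-positions : ∀ i j → h i ≢ h j → ¬ toℕ i ≈ toℕ j
    distinct-positions i j ne e = ne (trans (sym (at-toℕ i)) (trans (at-cong e) (at-toℕ j)))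

    at-positions : ∀ (P : Fin m → Fin m → Set) i j → P (h i) (h j) → P (at (toℕ i)) (at (toℕ j))
    at-positions P i j = subst₂ P (sym (at-toℕ i)) (sym (at-toℕ j))

  hole-dominated-edge : ∀ i j → h i ≢ h j → θ (h i) (h j) ≡ strong → ¬ Dominates θ (h i) (h j)
  hole-dominated-edge i j ne st dom =
    dominated-edge (toℕ i) (toℕ j) (distinct-positions i j ne)
      (at-positions (λ u v → θ u v ≡ strong) i j st) (at-positions (Dominates θ) i j dom)

  hole-dominated-nonedge : 5 ≤ K → ∀ i j → h i ≢ h j → θ (h i) (h j) ≡ anti →
    ¬ Dominates θ (h i) (h j)
  hole-dominated-nonedge 5≤K i j ne an dom =
    dominated-nonedge 5≤K (toℕ i) (toℕ j) (distinct-positions i j ne)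
      (at-positions (λ u v → θ u v ≡ anti) i j an) (at-positions (Dominates θ) i j dom)

-- A hole transfers along a map of its vertices that keeps every adjacency, except
-- that a pair may become switchable (switchable pairs are adjacent and antiadjacent).
hole-transfer : ∀ {m m′} (θ₁ : Fin m → Fin m → Adj) (θ₂ : Fin m′ → Fin m′ → Adj)
  k (h₁ : Fin k → Fin m) (h₂ : Fin k → Fin m′) → IsHole θ₁ k h₁ → Injective _≡_ _≡_ h₂ →
  (∀ i j → i ≢ j → θ₂ (h₂ i) (h₂ j) ≡ θ₁ (h₁ i) (h₁ j) ⊎ θ₂ (h₂ i) (h₂ j) ≡ semi) →
  IsHole θ₂ k h₂
hole-transfer θ₁ θ₂ k h₁ h₂ (4≤k , _ , adj , anti-adj) h₂-injective agree =
  4≤k , h₂-injective , adj₂ , anti-adj₂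
  where
  distinct : ∀ {i j : Fin k} → toℕ i < toℕ j → i ≢ j
  distinct lt refl = <-irrefl refl lt
  adj₂ : ∀ i j → toℕ i < toℕ j → (toℕ j ∸ toℕ i ≡ 1 ⊎ toℕ j ∸ toℕ i ≡ k ∸ 1) →
    Adjacent θ₂ (h₂ i) (h₂ j)
  adj₂ i j lt d with agree i j (distinct lt)
  ... | inj₁ e = subst (_≢ anti) (sym e) (adj i j lt d)
  ... | inj₂ e = subst (_≢ anti) (sym e) λ ()
  anti-adj₂ : ∀ i j → toℕ i < toℕ j → 1 < toℕ j ∸ toℕ i → toℕ j ∸ toℕ i < k ∸ 1 →
    Antiadjacent θ₂ (h₂ i) (h₂ j)
  anti-adj₂ i j lt d₁ d₂ with agree i j (distinct lt)
  ... | inj₁ e = subst (_≢ strong) (sym e) (anti-adj i j lt d₁ d₂)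
  ... | inj₂ e = subst (_≢ strong) (sym e) λ ()

odd-hole-no-dominated-pair : ∀ {m} (θ : Fin m → Fin m → Adj) → (∀ u v → θ u v ≡ θ v u) →
  ∀ k (h : Fin k → Fin m) → IsHole θ k h → k % 2 ≡ 1 →
  ∀ i j → h i ≢ h j → θ (h i) (h j) ≢ semi → ¬ Dominates θ (h i) (h j)
odd-hole-no-dominated-pair θ θ-sym (suc k) h hole odd i j ne not-semi dom
  with θ (h i) (h j) in e
... | strong = hole-dominated-edge i j ne e dom
  where open CyclicHole θ θ-sym k h hole
... | anti = hole-dominated-nonedge 5≤K i j ne e dom
  where
  open CyclicHole θ θ-sym k h hole
  5≤K : 5 ≤ K
  5≤K = ≤∧≢⇒< 4≤K λ { refl → contradiction odd λ () }
... | semi = contradiction refl not-semi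

-- The common shape of the four operations: the switchable pair ab of T becomes a strong
-- edge and a new vertex a′ (= zero) is strongly adjacent exactly to the vertices v ≠ a
-- with N v, where N agrees with N_T(a) \ {b} away from a.
module Split {n : ℕ} (T : Trigraph n) (θ-sym : ∀ u v → θ T u v ≡ θ T v u) (mono : Monogamous T)
             (a b : Fin n) (a≢b : a ≢ b) (ab : θ T a b ≡ semi)
             (N : Fin n → Bool) (N-off-a : ∀ v → v ≢ a → N v ≡ inNa T a b v) where

  b≢a : b ≢ a
  b≢a = a≢b ∘ sym

  partner-of-a : ∀ v → v ≢ a → θ T a v ≡ semi → v ≡ b
  partner-of-a v v≢a av = mono a v b v≢a b≢a av ab

  partner-of-b : ∀ v → v ≢ b → θ T b v ≡ semi → v ≡ a
  partner-of-b v v≢b bv = mono b v a v≢b a≢b bv (trans (θ-sym b a) ab)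

  a-strong-or-anti : ∀ v → v ≢ a → v ≢ b → θ T a v ≡ strong ⊎ θ T a v ≡ anti
  a-strong-or-anti v v≢a v≢b with θ T a v in e
  ... | strong = inj₁ refl
  ... | semi   = contradiction (partner-of-a v v≢a e) v≢b
  ... | anti   = inj₂ refl

  θ′ : Fin (suc n) → Fin (suc n) → Adj
  θ′ = mkθ T a b N

  θ⋆ : Fin n → Fin n → Adj
  θ⋆ u v = θ′ (suc u) (suc v)

  isAB-cases : ∀ u v → isAB T a b u v ≡ true → (u ≡ a × v ≡ b) ⊎ (u ≡ b × v ≡ a)
  isAB-cases u v e with u ==F a in ua | v ==F b in vb | u ==F b in ub | v ==F a in va
  ... | true  | true  | _     | _     = inj₁ (==F-≡ ua , ==F-≡ vb)
  ... | _     | _     | true  | true  = inj₂ (==F-≡ ub , ==F-≡ va)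
  ... | false | _     | false | _     = contradiction e λ ()
  ... | false | _     | true  | false = contradiction e λ ()
  ... | true  | false | false | _     = contradiction e λ ()
  ... | true  | false | true  | false = contradiction e λ ()

  isAB-semi : ∀ u v → isAB T a b u v ≡ true → θ T u v ≡ semi
  isAB-semi u v e with isAB-cases u v e
  ... | inj₁ (refl , refl) = ab
  ... | inj₂ (refl , refl) = trans (θ-sym b a) ab

  isAB-ab : isAB T a b a b ≡ true
  isAB-ab rewrite ==F-refl a | ==F-refl b = refl

  isAB-other : ∀ {u v} → v ≢ a → v ≢ b → isAB T a b u v ≡ false
  isAB-other {u} {v} v≢a v≢b rewrite ==F-≢ v≢a | ==F-≢ v≢b =
    cong₂ _∨_ (∧-zeroʳ (u ==F a)) (∧-zeroʳ (u ==F b))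

  θ⋆-ab : θ⋆ a b ≡ strong
  θ⋆-ab rewrite isAB-ab = refl

  θ⋆-other : ∀ {u v} → v ≢ a → v ≢ b → θ⋆ u v ≡ θ T u v
  θ⋆-other {u} {v} v≢a v≢b rewrite isAB-other {u} {v} v≢a v≢b = refl

  isAB-sym : ∀ u v → isAB T a b u v ≡ isAB T a b v u
  isAB-sym u v = trans (∨-comm (u ==F a ∧ v ==F b) _) (cong₂ _∨_ (∧-comm (u ==F b) _) (∧-comm (u ==F a) _))

  θ′-sym : ∀ u v → θ′ u v ≡ θ′ v u
  θ′-sym zero    zero    = refl
  θ′-sym zero    (suc v) = refl
  θ′-sym (suc u) zero    = refl
  θ′-sym (suc u) (suc v) rewrite isAB-sym u v | θ-sym u v = refl

  a′-copies-a : ∀ v → v ≢ a → v ≢ b → θ′ zero (suc v) ≡ θ T a v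
  a′-copies-a v v≢a v≢b rewrite N-off-a v v≢a | ==F-≢ v≢a | ==F-≢ v≢b
    with a-strong-or-anti v v≢a v≢b
  ... | inj₁ e rewrite e = refl
  ... | inj₂ e rewrite e = refl

  a′-misses-b : θ′ zero (suc b) ≡ anti
  a′-misses-b rewrite N-off-a b b≢a | ==F-≢ b≢a | ==F-refl b = refl

  a′-never-semi : ∀ v → θ′ zero v ≢ semi
  a′-never-semi zero    ()
  a′-never-semi (suc v) with N v
  ... | true  = λ ()
  ... | false = λ ()

  φ : Fin (suc n) → Fin n
  φ zero    = a
  φ (suc v) = v

  Merged : Fin (suc n) → Fin (suc n) → Set
  Merged u v = (u ≡ zero × v ≡ suc a) ⊎ (u ≡ suc a × v ≡ zero)

  φ-merges : ∀ u v → φ u ≡ φ v → u ≡ v ⊎ Merged u v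
  φ-merges zero    zero    _ = inj₁ refl
  φ-merges zero    (suc v) e = inj₂ (inj₁ (refl , cong suc (sym e)))
  φ-merges (suc u) zero    e = inj₂ (inj₂ (cong suc e , refl))
  φ-merges (suc u) (suc v) e = inj₁ (cong suc e)

  merged-sym : ∀ {u v} → Merged u v → Merged v u
  merged-sym (inj₁ (e , e′)) = inj₂ (e′ , e)
  merged-sym (inj₂ (e , e′)) = inj₁ (e′ , e)

  φ-agrees : ∀ u v → u ≢ v → ¬ Merged u v →
    θ T (φ u) (φ v) ≡ θ′ u v ⊎ θ T (φ u) (φ v) ≡ semi
  φ-agrees zero    zero    u≢v _ = contradiction refl u≢v
  φ-agrees zero    (suc v) _   ¬m with v ≟F a | v ≟F b
  ... | yes refl | _        = contradiction (inj₁ (refl , refl)) ¬m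
  ... | no _     | yes refl = inj₂ ab
  ... | no v≢a   | no v≢b   = inj₁ (sym (a′-copies-a v v≢a v≢b))
  φ-agrees (suc u) zero    u≢v ¬m with φ-agrees zero (suc u) (u≢v ∘ sym) (¬m ∘ merged-sym)
  ... | inj₁ e = inj₁ (trans (θ-sym u a) e)
  ... | inj₂ e = inj₂ (trans (θ-sym u a) e)
  φ-agrees (suc u) (suc v) _   _ with isAB T a b u v in e
  ... | true  = inj₂ (isAB-semi u v e)
  ... | false = inj₁ refl

  complement-agrees : ∀ u v → u ≢ v → ¬ Merged u v →
    complement (θ T) (φ u) (φ v) ≡ complement θ′ u v ⊎ complement (θ T) (φ u) (φ v) ≡ semi
  complement-agrees u v u≢v ¬m with φ-agrees u v u≢v ¬m
  ... | inj₁ e = inj₁ (cong negA e)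
  ... | inj₂ e = inj₂ (cong negA e)

  a′-dominated : Dominates θ′ (suc a) zero
  a′-dominated zero    _    v≢0 _   = contradiction refl v≢0
  a′-dominated (suc v) v≢a′ _   adj = by-cases (v ≟F a) (v ≟F b)
    where
    by-cases : Dec (v ≡ a) → Dec (v ≡ b) → θ⋆ a v ≡ strong
    by-cases (yes refl) _          = contradiction refl v≢a′
    by-cases (no _)     (yes refl) = contradiction a′-misses-b adj
    by-cases (no v≢a)   (no v≢b) with a-strong-or-anti v v≢a v≢b
    ... | inj₁ e = trans (θ⋆-other v≢a v≢b) e
    ... | inj₂ e = contradiction (trans (a′-copies-a v v≢a v≢b) e) adj

  a-dominated-in-complement : Dominates (complement θ′) zero (suc a)
  a-dominated-in-complement zero    v≢0  _    _   = contradiction refl v≢0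
  a-dominated-in-complement (suc v) _    v≢a′ adj = by-cases (v ≟F a) (v ≟F b)
    where
    by-cases : Dec (v ≡ a) → Dec (v ≡ b) → negA (θ′ zero (suc v)) ≡ strong
    by-cases (yes refl) _          = contradiction refl v≢a′
    by-cases (no _)     (yes refl) = contradiction (cong negA θ⋆-ab) adj
    by-cases (no v≢a)   (no v≢b) with a-strong-or-anti v v≢a v≢b
    ... | inj₁ e = contradiction (cong negA (trans (θ⋆-other v≢a v≢b) e)) adj
    ... | inj₂ e = cong negA (trans (a′-copies-a v v≢a v≢b) e)

  module _ (ϑ′ : Fin (suc n) → Fin (suc n) → Adj) (ϑ : Fin n → Fin n → Adj)
           (agrees : ∀ u v → u ≢ v → ¬ Merged u v →
                     ϑ (φ u) (φ v) ≡ ϑ′ u v ⊎ ϑ (φ u) (φ v) ≡ semi) where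

    project-hole : ∀ k h → IsHole ϑ′ k h → (∀ i j → ¬ Merged (h i) (h j)) → IsHole ϑ k (φ ∘ h)
    project-hole k h hole unmerged =
      hole-transfer ϑ′ ϑ k h (φ ∘ h) hole φh-injective
        (λ i j i≢j → agrees (h i) (h j) (i≢j ∘ h-injective) (unmerged i j))
      where
      h-injective : Injective _≡_ _≡_ h
      h-injective = proj₁ (proj₂ hole)
      φh-injective : Injective _≡_ _≡_ (φ ∘ h)
      φh-injective {i} {j} e with φ-merges (h i) (h j) e
      ... | inj₁ e′ = h-injective e′
      ... | inj₂ m  = contradiction m (unmerged i j)

    no-odd-hole : (∀ k h → k % 2 ≡ 1 → ¬ IsHole ϑ k h) →
      (∀ k h → IsHole ϑ′ k h → k % 2 ≡ 1 → ∀ i j → h i ≡ suc a → h j ≡ zero → ⊥) →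
      ∀ k h → k % 2 ≡ 1 → ¬ IsHole ϑ′ k h
    no-odd-hole old-free pair-free k h odd hole
      with any? (λ i → h i ≟F suc a) | any? (λ j → h j ≟F zero)
    ... | yes (i , hi) | yes (j , hj) = pair-free k h hole odd i j hi hj
    ... | no no-a      | _            = old-free k (φ ∘ h) odd (project-hole k h hole unmerged)
      where
      unmerged : ∀ i j → ¬ Merged (h i) (h j)
      unmerged i j (inj₁ (_ , e)) = no-a (j , e)
      unmerged i j (inj₂ (e , _)) = no-a (i , e)
    ... | yes _        | no no-a′     = old-free k (φ ∘ h) odd (project-hole k h hole unmerged)
      where
      unmerged : ∀ i j → ¬ Merged (h i) (h j)
      unmerged i j (inj₁ (e , _)) = no-a′ (i , e)
      unmerged i j (inj₂ (_ , e)) = no-a′ (j , e)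

  preserves-Berge : Berge T → ∀ k h → k % 2 ≡ 1 → ¬ IsHole θ′ k h × ¬ IsAntihole θ′ k h
  preserves-Berge berge k h odd =
    no-odd-hole θ′ (θ T) φ-agrees (λ k h odd → proj₁ (berge k h odd)) hole-pair k h odd ,
    no-odd-hole (complement θ′) (complement (θ T)) complement-agrees
      (λ k h odd → proj₂ (berge k h odd)) antihole-pair k h odd
    where
    a≢a′ : ∀ {x y} → x ≡ suc a → y ≡ zero → x ≢ y
    a≢a′ refl refl ()
    hole-pair : ∀ k h → IsHole θ′ k h → k % 2 ≡ 1 → ∀ i j → h i ≡ suc a → h j ≡ zero → ⊥
    hole-pair k h hole odd i j hi hj =
      odd-hole-no-dominated-pair θ′ θ′-sym k h hole odd i j (a≢a′ hi hj)
        (subst₂ (λ x y → θ′ x y ≢ semi) (sym hi) (sym hj) (a′-never-semi (suc a)))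
        (subst₂ (Dominates θ′) (sym hi) (sym hj) a′-dominated)
    antihole-pair : ∀ k h → IsAntihole θ′ k h → k % 2 ≡ 1 → ∀ i j → h i ≡ suc a → h j ≡ zero → ⊥
    antihole-pair k h hole odd i j hi hj =
      odd-hole-no-dominated-pair (complement θ′) (λ u v → cong negA (θ′-sym u v)) k h hole odd j i
        (a≢a′ hi hj ∘ sym)
        (subst₂ (λ x y → negA (θ′ x y) ≢ semi) (sym hj) (sym hi) (negA-not-semi (a′-never-semi (suc a))))
        (subst₂ (Dominates (complement θ′)) (sym hj) (sym hi) a-dominated-in-complement)
      where
      negA-not-semi : ∀ {x} → x ≢ semi → negA x ≢ semi
      negA-not-semi {strong} _ ()
      negA-not-semi {semi}   s = contradiction refl s
      negA-not-semi {anti}   _ ()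

module _ {n : ℕ} (U : Trigraph n) where

  stable-elim : ∀ {S} → stable U S ≡ true →
    ∀ u v → S u ≡ true → S v ≡ true → u ≢ v → θ U u v ≢ strong
  stable-elim {S} st u v su sv u≢v θ≡strong =
    contradiction (trans (sym (allF-elim n (allF-elim n st u) v))
                         (unstable-pair su sv (==F-≢ u≢v) (cong isStrong θ≡strong))) λ ()
    where
    unstable-pair : ∀ {x y z s} → x ≡ true → y ≡ true → z ≡ false → s ≡ true →
      not (x ∧ y ∧ not z ∧ s) ≡ false
    unstable-pair refl refl refl refl = refl

  stable-intro : ∀ {S} → (∀ u v → S u ≡ true → S v ≡ true → u ≢ v → θ U u v ≢ strong) →
    stable U S ≡ true
  stable-intro {S} f = allF-intro n λ u → allF-intro n λ v → pair-ok u v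
    where
    pair-ok : ∀ u v → not (S u ∧ S v ∧ not (u ==F v) ∧ isStrong (θ U u v)) ≡ true
    pair-ok u v with S u in su | S v in sv | u ≟F v
    ... | false | _     | _   = refl
    ... | true  | false | _   = refl
    ... | true  | true  | yes _ = refl
    ... | true  | true  | no u≢v with θ U u v in e
    ...   | strong = contradiction e (f u v su sv u≢v)
    ...   | semi   = refl
    ...   | anti   = refl

  core-elim : ∀ S v → inCore U S v ≡ true →
    S v ≡ true × (∀ u → S u ≡ true → u ≢ v → θ U u v ≡ anti)
  core-elim S v c with S v
  ... | true = refl , λ u su u≢v →
    antiadjacent-member su (==F-≢ u≢v) (allF-elim n c u)
    where
    antiadjacent-member : ∀ {x z t} → x ≡ true → z ≡ false → not (x ∧ not z ∧ not (isAnti t)) ≡ true →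
      t ≡ anti
    antiadjacent-member {t = anti} _ _ _ = refl
    antiadjacent-member {t = strong} refl refl ()
    antiadjacent-member {t = semi} refl refl ()

  core-intro : ∀ S v → S v ≡ true → (∀ u → S u ≡ true → u ≢ v → θ U u v ≡ anti) →
    inCore U S v ≡ true
  core-intro S v sv f rewrite sv = allF-intro n member-ok
    where
    member-ok : ∀ u → not (S u ∧ not (u ==F v) ∧ not (isAnti (θ U u v))) ≡ true
    member-ok u with S u in su | u ≟F v
    ... | false | _     = refl
    ... | true  | yes _ = refl
    ... | true  | no u≢v rewrite f u su u≢v = refl

  stable-cong : ∀ {S S′} → (∀ i → S i ≡ S′ i) → stable U S ≡ stable U S′
  stable-cong e = allF-cong n λ u → allF-cong n λ v →
    cong₂ (λ p q → not (p ∧ q ∧ _)) (e u) (e v)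

  weight-cong : ∀ {S S′} → (∀ i → S i ≡ S′ i) → weight U S ≡ weight U S′
  weight-cong e = cong₂ _+_
    (sumF-cong n λ v → cong (λ p → if p then _ else 0)
      (cong₂ _∧_ (e v) (allF-cong n λ u → cong (λ p → not (p ∧ _)) (e u))))
    (sumF-cong n λ u → sumF-cong n λ v → cong₂ (λ p q → if p ∧ q ∧ _ then _ else 0) (e u) (e v))

  core-without-semi : ∀ S v → stable U S ≡ true →
    (∀ u → S u ≡ true → u ≢ v → θ U u v ≢ semi) → inCore U S v ≡ S v
  core-without-semi S v st no-semi =
    ≡-by-truth (proj₁ ∘ core-elim S v) λ sv → core-intro S v sv λ u su u≢v →
      strong-semi-or-anti (stable-elim st u v su sv u≢v) (no-semi u su u≢v)
    where
    strong-semi-or-anti : ∀ {x} → x ≢ strong → x ≢ semi → x ≡ anti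
    strong-semi-or-anti {strong} s _ = contradiction refl s
    strong-semi-or-anti {semi}   _ s = contradiction refl s
    strong-semi-or-anti {anti}   _ _ = refl

  core-with-semi : ∀ S u v → S u ≡ true → u ≢ v → θ U u v ≡ semi → inCore U S v ≡ false
  core-with-semi S u v su u≢v uv with inCore U S v in c
  ... | false = refl
  ... | true  = contradiction (trans (sym uv) (proj₂ (core-elim S v c) u su u≢v)) λ ()

private
  foldr-⊔-upper : ∀ {x} xs → x ∈ xs → x ≤ foldr _⊔_ 0 xs
  foldr-⊔-upper (y ∷ ys) (here refl) = m≤m⊔n y _
  foldr-⊔-upper (y ∷ ys) (there p)   = ≤-trans (foldr-⊔-upper ys p) (m≤n⊔m y _)

  foldr-⊔-least : ∀ {c} xs → (∀ {x} → x ∈ xs → x ≤ c) → foldr _⊔_ 0 xs ≤ c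
  foldr-⊔-least []       _ = z≤n
  foldr-⊔-least (y ∷ ys) f = ⊔-lub (f (here refl)) (foldr-⊔-least ys (f ∘ there))

  allSubsets-complete : ∀ n (S : Subset n) →
    Σ (Subset n) λ S₀ → S₀ ∈ allSubsets n × (∀ i → S₀ i ≡ S i)
  allSubsets-complete zero    S = (λ ()) , here refl , λ ()
  allSubsets-complete (suc n) S with allSubsets-complete n (λ i → S (suc i)) | S zero in s₀
  ... | S₁ , p , e | false = _ , ∈-++⁺ˡ (∈-map⁺ _ p) , agree
    where
    agree : ∀ i → _ ≡ S i
    agree zero    = sym s₀
    agree (suc i) = e i
  ... | S₁ , p , e | true = _ , ∈-++⁺ʳ _ (∈-map⁺ _ p) , agree
    where
    agree : ∀ i → _ ≡ S i
    agree zero    = sym s₀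
    agree (suc i) = e i

module _ {n : ℕ} (U : Trigraph n) where

  α-upper : ∀ S → stable U S ≡ true → weight U S ≤ α U
  α-upper S st with allSubsets-complete n S
  ... | S₀ , mem , e = subst (_≤ α U) value (foldr-⊔-upper _ (∈-map⁺ candidate mem))
    where
    candidate : Subset n → ℕ
    candidate S = if stable U S then weight U S else 0
    value : candidate S₀ ≡ weight U S
    value rewrite stable-cong U e | st = weight-cong U e

  α-least : ∀ {c} → (∀ S → stable U S ≡ true → weight U S ≤ c) → α U ≤ c
  α-least {c} f = foldr-⊔-least _ λ mem → bounded (∈-map⁻ _ mem)
    where
    bounded : ∀ {x} → Σ (Subset n) (λ S → S ∈ allSubsets n × x ≡ (if stable U S then weight U S else 0)) → x ≤ c
    bounded (S , _ , refl) with stable U S in st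
    ... | true  = f S st
    ... | false = z≤n

α-mono : ∀ {n n′} (U : Trigraph n) (U′ : Trigraph n′) →
  (∀ S → stable U S ≡ true → Σ (Subset n′) λ S′ → stable U′ S′ ≡ true × weight U S ≤ weight U′ S′) →
  α U ≤ α U′
α-mono U U′ f = α-least U λ S st → let (S′ , st′ , le) = f S st in ≤-trans le (α-upper U′ S′ st′)

coreSum : ∀ {n} → Trigraph n → Subset n → ℕ
coreSum {n} U S = sumF n λ v → inCore U S v · w U v

pairSum : ∀ {n} → (Fin n → Fin n → Adj) → (Fin n → Fin n → ℕ) → Subset n → ℕ
pairSum {n} θ p S = sumF n λ u → sumF n λ v →
  (S u ∧ S v ∧ ⌊ toℕ u <? toℕ v ⌋ ∧ isSemi (θ u v)) · p u v

module SplitWeights {n : ℕ} (T : Trigraph n) (θ-sym : ∀ u v → θ T u v ≡ θ T v u)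
    (wp-sym : ∀ u v → wp T u v ≡ wp T v u) (mono : Monogamous T)
    (a b : Fin n) (a≢b : a ≢ b) (ab : θ T a b ≡ semi)
    (N : Fin n → Bool) (N-off-a : ∀ v → v ≢ a → N v ≡ inNa T a b v)
    (wf : Fin (suc n) → ℕ) (wf-old : ∀ v → v ≢ a → wf (suc v) ≡ w T v) where

  open Split T θ-sym mono a b a≢b ab N N-off-a

  T′ : Trigraph (suc n)
  T′ = record { θ = θ′ ; w = wf ; wp = mkwp T a b }

  -- S is the image of S′ under φ (a record, so that S′ and S stay inferable)
  record Image (S′ : Subset (suc n)) (S : Subset n) : Set where
    constructor image
    field
      image-old : ∀ v → v ≢ a → S v ≡ S′ (suc v)
      image-a   : S a ≡ S′ (suc a) ∨ S′ zero

  image-member : ∀ {S′ S} → Image S′ S → ∀ u′ → S′ u′ ≡ true → S (φ u′) ≡ true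
  image-member {S′} (image _ at-a) zero s = trans at-a (trans (cong (S′ (suc a) ∨_) s) (∨-zeroʳ _))
  image-member {S′} (image off-a at-a) (suc u) s with u ≟F a
  ... | yes refl = trans at-a (cong (_∨ S′ zero) s)
  ... | no u≢a   = trans (off-a u u≢a) s

  image-preimage : ∀ {S′ S} → Image S′ S → ∀ u → S u ≡ true →
    Σ (Fin (suc n)) λ u′ → φ u′ ≡ u × S′ u′ ≡ true
  image-preimage {S′} (image off-a at-a) u s with u ≟F a
  ... | no u≢a = suc u , refl , trans (sym (off-a u u≢a)) s
  ... | yes refl with S′ (suc a) in sa
  ...   | true  = suc a , refl , sa
  ...   | false = zero , refl , trans (sym at-a) s

  merged-φ : ∀ {u v} → Merged u v → φ u ≡ φ v
  merged-φ (inj₁ (refl , refl)) = refl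
  merged-φ (inj₂ (refl , refl)) = refl

  image-stable : ∀ {S′ S} → Image S′ S → stable T′ S′ ≡ true → stable T S ≡ true
  image-stable {S′} {S} img st′ = stable-intro T λ u v su sv u≢v →
    separated (image-preimage img u su) (image-preimage img v sv) u≢v
    where
    separated : ∀ {u v} → Σ (Fin (suc n)) (λ u′ → φ u′ ≡ u × S′ u′ ≡ true) →
      Σ (Fin (suc n)) (λ v′ → φ v′ ≡ v × S′ v′ ≡ true) → u ≢ v → θ T u v ≢ strong
    separated (u′ , refl , su′) (v′ , refl , sv′) φu≢φv with
      φ-agrees u′ v′ (φu≢φv ∘ cong φ) (φu≢φv ∘ merged-φ)
    ... | inj₁ e = λ st → stable-elim T′ st′ u′ v′ su′ sv′ (φu≢φv ∘ cong φ) (trans (sym e) st)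
    ... | inj₂ e = λ st → contradiction (trans (sym e) st) λ ()

  -- conversely a set with stable image is stable unless it contains a and b, or a and a′
  -- joined by a strong edge (the only strong edges of T′ that do not come from T)
  stable-from-image : ∀ {S′ S} → Image S′ S → stable T S ≡ true →
    ¬ (S′ (suc a) ≡ true × S′ (suc b) ≡ true) →
    (S′ zero ≡ true → S′ (suc a) ≡ true → θ′ zero (suc a) ≢ strong) → stable T′ S′ ≡ true
  stable-from-image {S′} {S} img st no-ab no-aa′ = stable-intro T′ separated
    where
    a′-separated : ∀ v → S′ zero ≡ true → S′ (suc v) ≡ true → θ′ zero (suc v) ≢ strong
    a′-separated v s₀ sv = by-cases (v ≟F a) (v ≟F b)
      where
      by-cases : Dec (v ≡ a) → Dec (v ≡ b) → θ′ zero (suc v) ≢ strong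
      by-cases (yes refl) _          = no-aa′ s₀ sv
      by-cases (no _)     (yes refl) = λ e → contradiction (trans (sym a′-misses-b) e) λ ()
      by-cases (no v≢a)   (no v≢b)   = λ e →
        stable-elim T st a v (image-member img zero s₀) (image-member img (suc v) sv) (v≢a ∘ sym)
          (trans (sym (a′-copies-a v v≢a v≢b)) e)
    separated : ∀ u′ v′ → S′ u′ ≡ true → S′ v′ ≡ true → u′ ≢ v′ → θ′ u′ v′ ≢ strong
    separated zero    zero    _  _  u′≢v′ = contradiction refl u′≢v′
    separated zero    (suc v) s₀ sv _     = a′-separated v s₀ sv
    separated (suc u) zero    su s₀ _     = a′-separated u s₀ su
    separated (suc u) (suc v) su sv u′≢v′ with isAB T a b u v in e
    ... | true with isAB-cases u v e
    ...   | inj₁ (refl , refl) = λ _ → no-ab (su , sv)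
    ...   | inj₂ (refl , refl) = λ _ → no-ab (sv , su)
    separated (suc u) (suc v) su sv u′≢v′ | false =
      stable-elim T st u v (image-member img (suc u) su) (image-member img (suc v) sv) (u′≢v′ ∘ cong suc)

  a′-unswitchable : ∀ u′ → θ′ u′ zero ≢ semi
  a′-unswitchable zero    = λ ()
  a′-unswitchable (suc u) = a′-never-semi (suc u)

  a-unswitchable : ∀ u′ → u′ ≢ suc a → θ′ u′ (suc a) ≢ semi
  a-unswitchable zero    _   = a′-never-semi (suc a)
  a-unswitchable (suc u) u≢a = by-cases (u ≟F b)
    where
    by-cases : Dec (u ≡ b) → θ⋆ u a ≢ semi
    by-cases (yes refl) e = contradiction (trans (sym e) (trans (θ′-sym (suc b) (suc a)) θ⋆-ab)) λ ()
    by-cases (no u≢b)   e = u≢b (partner-of-a u (u≢a ∘ cong suc)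
      (trans (sym (θ⋆-other (u≢a ∘ cong suc) u≢b)) (trans (θ′-sym (suc a) (suc u)) e)))

  b-unswitchable : ∀ u′ → u′ ≢ suc b → θ′ u′ (suc b) ≢ semi
  b-unswitchable zero    _   = a′-never-semi (suc b)
  b-unswitchable (suc u) u≢b = by-cases (u ≟F a)
    where
    by-cases : Dec (u ≡ a) → θ⋆ u b ≢ semi
    by-cases (yes refl) e = contradiction (trans (sym e) θ⋆-ab) λ ()
    by-cases (no u≢a)   e = u≢a (partner-of-b u (u≢b ∘ cong suc)
      (trans (sym (θ⋆-other u≢a (u≢b ∘ cong suc))) (trans (θ′-sym (suc b) (suc u)) e)))

  core-of-partnered : ∀ x y → x ≢ y → θ T y x ≡ semi → (∀ u → u ≢ x → θ T u x ≡ semi → u ≡ y) →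
    ∀ S → stable T S ≡ true → inCore T S x ≡ S x ∧ not (S y)
  core-of-partnered x y x≢y yx partner S st with S y in sy
  ... | true  = trans (core-with-semi T S y x sy (x≢y ∘ sym) yx) (sym (∧-zeroʳ (S x)))
  ... | false = trans (core-without-semi T S x st λ u su u≢x e →
                         contradiction (trans (sym (subst (λ t → S t ≡ true) (partner u u≢x e) su)) sy) λ ())
                      (sym (∧-identityʳ (S x)))

  core-a : ∀ S → stable T S ≡ true → inCore T S a ≡ S a ∧ not (S b)
  core-a = core-of-partnered a b a≢b (trans (θ-sym b a) ab)
             λ u u≢a e → partner-of-a u u≢a (trans (θ-sym a u) e)

  core-b : ∀ S → stable T S ≡ true → inCore T S b ≡ S b ∧ not (S a)
  core-b = core-of-partnered b a b≢a ab
             λ u u≢b e → partner-of-b u u≢b (trans (θ-sym b u) e)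

  θ′-to-old : ∀ {v} → v ≢ a → v ≢ b → ∀ u′ → θ′ u′ (suc v) ≡ θ T (φ u′) v
  θ′-to-old v≢a v≢b zero    = a′-copies-a _ v≢a v≢b
  θ′-to-old v≢a v≢b (suc u) = θ⋆-other v≢a v≢b

  core′-old : ∀ {S′ S} → Image S′ S → ∀ v → v ≢ a → v ≢ b → inCore T′ S′ (suc v) ≡ inCore T S v
  core′-old {S′} {S} img v v≢a v≢b = ≡-by-truth to from
    where
    open Image img
    to : inCore T′ S′ (suc v) ≡ true → inCore T S v ≡ true
    to c′ = core-intro T S v (trans (image-old v v≢a) sv′) λ u su u≢v →
      let (u′ , φu′ , su′) = image-preimage img u su in
      trans (cong (λ t → θ T t v) (sym φu′))
        (trans (sym (θ′-to-old v≢a v≢b u′)) (anti′ u′ su′ λ e → u≢v (trans (sym φu′) (cong φ e))))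
      where
      sv′ : S′ (suc v) ≡ true
      sv′ = proj₁ (core-elim T′ S′ (suc v) c′)
      anti′ : ∀ u′ → S′ u′ ≡ true → u′ ≢ suc v → θ′ u′ (suc v) ≡ anti
      anti′ = proj₂ (core-elim T′ S′ (suc v) c′)
    from : inCore T S v ≡ true → inCore T′ S′ (suc v) ≡ true
    from c = core-intro T′ S′ (suc v) (trans (sym (image-old v v≢a)) (proj₁ (core-elim T S v c))) λ u′ su′ u′≢v →
      trans (θ′-to-old v≢a v≢b u′)
        (proj₂ (core-elim T S v c) (φ u′) (image-member img u′ su′) (φ-off u′ u′≢v))
      where
      φ-off : ∀ u′ → u′ ≢ suc v → φ u′ ≢ v
      φ-off zero    _     = v≢a ∘ sym
      φ-off (suc u) u′≢v = u′≢v ∘ cong suc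

  -- every switchable pair of T′ lies among the old vertices, where T′ is θ⋆
  pairSum-T′ : ∀ S′ → pairSum θ′ (mkwp T a b) S′ ≡ pairSum θ⋆ (wp T) (S′ ∘ suc)
  pairSum-T′ S′ = cong₂ _+_ (sumF-zero (suc n) λ v′ → ·-zero (term zero v′)) (sumF-cong n λ u →
    cong₂ _+_ (·-zero (term (suc u) zero)) (sumF-cong n λ v →
      cong (λ t → (S′ (suc u) ∧ S′ (suc v) ∧ t ∧ isSemi (θ⋆ u v)) · wp T u v) (<?-suc (toℕ u) (toℕ v))))
    where
    term : Fin (suc n) → Fin (suc n) → Bool
    term u′ v′ = S′ u′ ∧ S′ v′ ∧ ⌊ toℕ u′ <? toℕ v′ ⌋ ∧ isSemi (θ′ u′ v′)

  -- θ⋆ has no switchable pair at a, so its pair sum ignores whether a is present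
  pairSum-θ⋆-off-a : ∀ {R R′} → (∀ v → v ≢ a → R v ≡ R′ v) → pairSum θ⋆ (wp T) R ≡ pairSum θ⋆ (wp T) R′
  pairSum-θ⋆-off-a {R} {R′} agree = sumF-cong n λ u → sumF-cong n λ v → by-cases u v (u ≟F a) (v ≟F a)
    where
    no-pair-at-a : ∀ u v → u ≡ a ⊎ v ≡ a → ⌊ toℕ u <? toℕ v ⌋ ∧ isSemi (θ⋆ u v) ≡ false
    no-pair-at-a u v at-a with u ≟F v
    ... | yes refl = cong (_∧ isSemi (θ⋆ u u)) (<?-irrefl (toℕ u))
    ... | no u≢v   = trans (cong (⌊ toℕ u <? toℕ v ⌋ ∧_) (isSemi-false (not-semi at-a))) (∧-zeroʳ _)
      where
      not-semi : u ≡ a ⊎ v ≡ a → θ⋆ u v ≢ semi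
      not-semi (inj₁ refl) e = a-unswitchable (suc v) (u≢v ∘ sym ∘ suc-injective)
                                 (trans (θ′-sym (suc v) (suc a)) e)
      not-semi (inj₂ refl)   = a-unswitchable (suc u) (u≢v ∘ suc-injective)
    by-cases : ∀ u v → Dec (u ≡ a) → Dec (v ≡ a) →
      (R u ∧ R v ∧ ⌊ toℕ u <? toℕ v ⌋ ∧ isSemi (θ⋆ u v)) · wp T u v ≡
      (R′ u ∧ R′ v ∧ ⌊ toℕ u <? toℕ v ⌋ ∧ isSemi (θ⋆ u v)) · wp T u v
    by-cases u v (yes u≡a) _ = trans (vanishing (R u) (R v) (no-pair-at-a u v (inj₁ u≡a)))
                                     (sym (vanishing (R′ u) (R′ v) (no-pair-at-a u v (inj₁ u≡a))))
    by-cases u v (no _) (yes v≡a) = trans (vanishing (R u) (R v) (no-pair-at-a u v (inj₂ v≡a)))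
                                          (sym (vanishing (R′ u) (R′ v) (no-pair-at-a u v (inj₂ v≡a))))
    by-cases u v (no u≢a) (no v≢a) rewrite agree u u≢a | agree v v≢a = refl

  pairSum-T : ∀ S → pairSum (θ T) (wp T) S ≡ pairSum θ⋆ (wp T) S + (S a ∧ S b) · wp T a b
  pairSum-T S = begin
    pairSum (θ T) (wp T) S
      ≡⟨ sumF-cong n (λ u → trans (sumF-cong n (split-term u)) (sumF-+ n _ _)) ⟩
    sumF n (λ u → sumF n (g u) + sumF n (δ u))
      ≡⟨ sumF-+ n _ _ ⟩
    pairSum θ⋆ (wp T) S + sumF n (λ u → sumF n (δ u))
      ≡⟨ cong (pairSum θ⋆ (wp T) S +_) (trans (sumF-split₂ n a≢b _) rows) ⟩
    pairSum θ⋆ (wp T) S + (f a b + f b a)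
      ≡⟨ cong (pairSum θ⋆ (wp T) S +_) ab-and-ba ⟩
    pairSum θ⋆ (wp T) S + (S a ∧ S b) · wp T a b ∎
    where
    open ≡-Reasoning
    lt : Fin n → Fin n → Bool
    lt u v = ⌊ toℕ u <? toℕ v ⌋
    f g δ : Fin n → Fin n → ℕ
    f u v = (S u ∧ S v ∧ lt u v ∧ isSemi (θ T u v)) · wp T u v
    g u v = (S u ∧ S v ∧ lt u v ∧ isSemi (θ⋆ u v)) · wp T u v
    δ u v = isAB T a b u v · f u v
    split-term : ∀ u v → f u v ≡ g u v + δ u v
    split-term u v with isAB T a b u v
    ... | false = sym (+-identityʳ _)
    ... | true  = cong (_+ f u v) (sym (vanishing (S u) (S v) (∧-zeroʳ (lt u v))))
    row-a : sumF n (δ a) ≡ f a b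
    row-a = trans (sumF-point n b λ v v≢b → cong (_· f a v) (isAB-a v≢b)) (cong (_· f a b) isAB-ab)
      where
      isAB-a : ∀ {v} → v ≢ b → isAB T a b a v ≡ false
      isAB-a v≢b rewrite ==F-refl a | ==F-≢ v≢b | ==F-≢ a≢b = refl
    row-b : sumF n (δ b) ≡ f b a
    row-b = trans (sumF-point n a λ v v≢a → cong (_· f b v) (isAB-b v≢a))
                  (cong (_· f b a) (trans (isAB-sym b a) isAB-ab))
      where
      isAB-b : ∀ {v} → v ≢ a → isAB T a b b v ≡ false
      isAB-b v≢a rewrite ==F-refl b | ==F-≢ v≢a | ==F-≢ b≢a = refl
    other-row : ∀ u → Dec (u ≡ a) → Dec (u ≡ b) → not (u ==F a ∨ u ==F b) · sumF n (δ u) ≡ 0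
    other-row u (yes refl) _ rewrite ==F-refl u = refl
    other-row u (no u≢a) (yes refl) rewrite ==F-≢ u≢a | ==F-refl u = refl
    other-row u (no u≢a) (no u≢b) rewrite ==F-≢ u≢a | ==F-≢ u≢b = sumF-zero n λ _ → refl
    rows : sumF n (δ a) + sumF n (δ b) + sumF n (λ u → not (u ==F a ∨ u ==F b) · sumF n (δ u)) ≡
           f a b + f b a
    rows = trans (cong₂ _+_ (cong₂ _+_ row-a row-b) (sumF-zero n λ u → other-row u (u ≟F a) (u ≟F b)))
                 (+-identityʳ _)
    -- exactly one of the orders (a, b), (b, a) is counted
    ab-and-ba : f a b + f b a ≡ (S a ∧ S b) · wp T a b
    ab-and-ba rewrite ab | trans (θ-sym b a) ab | wp-sym b a = one-order (S a) (S b) (<?-connex a≢b)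
      where
      one-order : ∀ x y {l l′ m} → (l ≡ true × l′ ≡ false) ⊎ (l ≡ false × l′ ≡ true) →
        (x ∧ y ∧ l ∧ true) · m + (y ∧ x ∧ l′ ∧ true) · m ≡ (x ∧ y) · m
      one-order false false       _                    = refl
      one-order false true        _                    = refl
      one-order true  false       _                    = refl
      one-order true  true  {m = m} (inj₁ (refl , refl)) = +-identityʳ m
      one-order true  true        (inj₂ (refl , refl)) = refl

  localT : Bool → Bool → ℕ
  localT sa sb = (sa ∧ not sb) · w T a + (sb ∧ not sa) · w T b + (sa ∧ sb) · wp T a b

  localT′ : Subset (suc n) → ℕ
  localT′ S′ = S′ zero · wf zero + S′ (suc a) · wf (suc a) + S′ (suc b) · w T b

  common : Subset n → ℕ
  common S = sumF n (λ v → not (v ==F a ∨ v ==F b) · (inCore T S v · w T v)) + pairSum θ⋆ (wp T) S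

  weight-T : ∀ S → stable T S ≡ true → weight T S ≡ localT (S a) (S b) + common S
  weight-T S st = begin
    coreSum T S + pairSum (θ T) (wp T) S
      ≡⟨ cong₂ _+_ (sumF-split₂ n a≢b _) (pairSum-T S) ⟩
    inCore T S a · w T a + inCore T S b · w T b + R + (P + E)
      ≡⟨ cong (λ t → t + R + (P + E)) (cong₂ _+_ (cong (_· w T a) (core-a S st))
                                                  (cong (_· w T b) (core-b S st))) ⟩
    A + B + R + (P + E)
      ≡⟨ regroup A B E R P ⟩
    A + B + E + (R + P) ∎
    where
    open ≡-Reasoning
    A B E R P : ℕ
    A = (S a ∧ not (S b)) · w T a
    B = (S b ∧ not (S a)) · w T b
    E = (S a ∧ S b) · wp T a b
    R = sumF n (λ v → not (v ==F a ∨ v ==F b) · (inCore T S v · w T v))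
    P = pairSum θ⋆ (wp T) S
    regroup : ∀ A B E R P → A + B + R + (P + E) ≡ A + B + E + (R + P)
    regroup = solve-∀

  weight-T′ : ∀ S′ S → Image S′ S → stable T′ S′ ≡ true → weight T′ S′ ≡ localT′ S′ + common S
  weight-T′ S′ S img st′ = begin
    inCore T′ S′ zero · wf zero + sumF n (λ v → inCore T′ S′ (suc v) · wf (suc v)) +
      pairSum θ′ (mkwp T a b) S′
      ≡⟨ cong₂ _+_ (cong₂ _+_ (cong (_· wf zero) core′-a′) (sumF-split₂ n a≢b _))
                   (trans (pairSum-T′ S′) (pairSum-θ⋆-off-a λ v v≢a → sym (image-old v v≢a))) ⟩
    Z + (inCore T′ S′ (suc a) · wf (suc a) + inCore T′ S′ (suc b) · wf (suc b) + R′) + P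
      ≡⟨ cong (λ t → Z + t + P) (cong₂ _+_ (cong₂ _+_ (cong (_· wf (suc a)) core′-a)
                                                     (cong₂ _·_ core′-b (wf-old b b≢a)))
                                            (sumF-cong n λ v → rest-term v (v ≟F a) (v ≟F b))) ⟩
    Z + (A′ + B′ + R) + P
      ≡⟨ regroup Z A′ B′ R P ⟩
    Z + A′ + B′ + (R + P) ∎
    where
    open ≡-Reasoning
    open Image img
    Z A′ B′ R R′ P : ℕ
    Z  = S′ zero · wf zero
    A′ = S′ (suc a) · wf (suc a)
    B′ = S′ (suc b) · w T b
    R  = sumF n (λ v → not (v ==F a ∨ v ==F b) · (inCore T S v · w T v))
    R′ = sumF n (λ v → not (v ==F a ∨ v ==F b) · (inCore T′ S′ (suc v) · wf (suc v)))
    P  = pairSum θ⋆ (wp T) S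
    core′-a′ : inCore T′ S′ zero ≡ S′ zero
    core′-a′ = core-without-semi T′ S′ zero st′ λ u′ _ _ → a′-unswitchable u′
    core′-a : inCore T′ S′ (suc a) ≡ S′ (suc a)
    core′-a = core-without-semi T′ S′ (suc a) st′ λ u′ _ → a-unswitchable u′
    core′-b : inCore T′ S′ (suc b) ≡ S′ (suc b)
    core′-b = core-without-semi T′ S′ (suc b) st′ λ u′ _ → b-unswitchable u′
    rest-term : ∀ v → Dec (v ≡ a) → Dec (v ≡ b) →
      not (v ==F a ∨ v ==F b) · (inCore T′ S′ (suc v) · wf (suc v)) ≡
      not (v ==F a ∨ v ==F b) · (inCore T S v · w T v)
    rest-term v (yes refl) _ rewrite ==F-refl v = refl
    rest-term v (no v≢a) (yes refl) rewrite ==F-≢ v≢a | ==F-refl v = refl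
    rest-term v (no v≢a) (no v≢b) =
      cong (not (v ==F a ∨ v ==F b) ·_) (cong₂ _·_ (core′-old img v v≢a v≢b) (wf-old v v≢a))
    regroup : ∀ Z A′ B′ R P → Z + (A′ + B′ + R) + P ≡ Z + A′ + B′ + (R + P)
    regroup = solve-∀

  weight-≤ : ∀ S′ S → Image S′ S → stable T S ≡ true → stable T′ S′ ≡ true →
    localT (S a) (S b) ≤ localT′ S′ → weight T S ≤ weight T′ S′
  weight-≤ S′ S img st st′ le = subst₂ _≤_ (sym (weight-T S st)) (sym (weight-T′ S′ S img st′))
    (+-monoˡ-≤ (common S) le)

  weight-≥ : ∀ S′ S → Image S′ S → stable T S ≡ true → stable T′ S′ ≡ true →
    localT′ S′ ≤ localT (S a) (S b) → weight T′ S′ ≤ weight T S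
  weight-≥ S′ S img st st′ le = subst₂ _≤_ (sym (weight-T′ S′ S img st′)) (sym (weight-T S st))
    (+-monoˡ-≤ (common S) le)

  forward : Subset n → Bool → Subset (suc n)
  forward S z zero    = z
  forward S z (suc v) = S v ∧ not (v ==F a ∧ S b)

  forward-a : ∀ S z → forward S z (suc a) ≡ S a ∧ not (S b)
  forward-a S z = cong (λ t → S a ∧ not (t ∧ S b)) (==F-refl a)

  forward-old : ∀ S z v → v ≢ a → forward S z (suc v) ≡ S v
  forward-old S z v v≢a = trans (cong (λ t → S v ∧ not (t ∧ S b)) (==F-≢ v≢a)) (∧-identityʳ (S v))

  forward-image : ∀ S z → S a ≡ (S a ∧ not (S b)) ∨ z → Image (forward S z) S
  forward-image S z covers =
    image (λ v v≢a → sym (forward-old S z v v≢a)) (trans covers (cong (_∨ z) (sym (forward-a S z))))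

  backward : Subset (suc n) → Subset n
  backward S′ v = S′ (suc v) ∨ (v ==F a ∧ S′ zero)

  backward-image : ∀ S′ → Image S′ (backward S′)
  backward-image S′ = image
    (λ v v≢a → trans (cong (λ t → S′ (suc v) ∨ (t ∧ S′ zero)) (==F-≢ v≢a)) (∨-identityʳ _))
    (cong (λ t → S′ (suc a) ∨ (t ∧ S′ zero)) (==F-refl a))

  α-T′≤α-T : (∀ ra rb z → ¬ (ra ≡ true × rb ≡ true) →
               (θ′ zero (suc a) ≡ strong → ¬ (ra ≡ true × z ≡ true)) →
               z · wf zero + ra · wf (suc a) + rb · w T b ≤ localT (ra ∨ z) rb) →
    α T′ ≤ α T
  α-T′≤α-T local = α-mono T′ T lift
    where
    lift : ∀ S′ → stable T′ S′ ≡ true →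
      Σ (Subset n) λ S → stable T S ≡ true × weight T′ S′ ≤ weight T S
    lift S′ st′ = backward S′ , st , weight-≥ S′ (backward S′) img st st′ local-part
      where
      img : Image S′ (backward S′)
      img = backward-image S′
      st : stable T (backward S′) ≡ true
      st = image-stable img st′
      no-ab : ¬ (S′ (suc a) ≡ true × S′ (suc b) ≡ true)
      no-ab (sa , sb) = stable-elim T′ {S′} st′ (suc a) (suc b) sa sb (a≢b ∘ suc-injective) θ⋆-ab
      no-aa′ : θ′ zero (suc a) ≡ strong → ¬ (S′ (suc a) ≡ true × S′ zero ≡ true)
      no-aa′ a′a (sa , s₀) = stable-elim T′ {S′} st′ zero (suc a) s₀ sa (λ ()) a′a
      local-part : localT′ S′ ≤ localT (backward S′ a) (backward S′ b)
      local-part = subst₂ (λ x y → localT′ S′ ≤ localT x y)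
        (sym (Image.image-a img)) (sym (Image.image-old img b b≢a))
        (local (S′ (suc a)) (S′ (suc b)) (S′ zero) no-ab no-aa′)

  α-T≤α-T′ : (z : Bool → Bool → Bool) → (∀ sa sb → sa ≡ (sa ∧ not sb) ∨ z sa sb) →
    (∀ sa sb → z sa sb ≡ true → sa ∧ not sb ≡ true → θ′ zero (suc a) ≢ strong) →
    (∀ sa sb → localT sa sb ≤ z sa sb · wf zero + (sa ∧ not sb) · wf (suc a) + sb · w T b) →
    α T ≤ α T′
  α-T≤α-T′ z covers separated local = α-mono T T′ lift
    where
    lift : ∀ S → stable T S ≡ true →
      Σ (Subset (suc n)) λ S′ → stable T′ S′ ≡ true × weight T S ≤ weight T′ S′
    lift S st = forward S z₀ , st′ , weight-≤ (forward S z₀) S img st st′ local-part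
      where
      z₀ : Bool
      z₀ = z (S a) (S b)
      img : Image (forward S z₀) S
      img = forward-image S z₀ (covers (S a) (S b))
      a-kept : forward S z₀ (suc a) ≡ true → S a ∧ not (S b) ≡ true
      a-kept = trans (sym (forward-a S z₀))
      no-ab : ¬ (forward S z₀ (suc a) ≡ true × forward S z₀ (suc b) ≡ true)
      no-ab (sa , sb) with S a | S b | a-kept sa | trans (sym (forward-old S z₀ b b≢a)) sb
      ... | true | true | () | _
      st′ : stable T′ (forward S z₀) ≡ true
      st′ = stable-from-image img st no-ab λ s₀ sa → separated (S a) (S b) s₀ (a-kept sa)
      local-part : localT (S a) (S b) ≤ localT′ (forward S z₀)
      local-part = subst₂ (λ x y → localT (S a) (S b) ≤ z₀ · wf zero + x · wf (suc a) + y · w T b)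
        (sym (forward-a S z₀)) (sym (forward-old S z₀ b b≢a)) (local (S a) (S b))

-- L sa sb is the weight that a, b contribute to a
-- stable set of T containing a (resp. b) iff sa (resp. sb).
module LocalWeights (wa wb W : ℕ) (wb≤W : wb ≤ W) (W≤wa+wb : W ≤ wa + wb) where

  X Y : ℕ
  X = W ∸ wb
  Y = wa + wb ∸ W

  X+wb≡W : X + wb ≡ W
  X+wb≡W = m∸n+n≡m wb≤W

  X+Y≡wa : X + Y ≡ wa
  X+Y≡wa = +-cancelʳ-≡ W (X + Y) wa (begin
    X + Y + W        ≡⟨ +-assoc X Y W ⟩
    X + (Y + W)      ≡⟨ cong (X +_) (m∸n+n≡m W≤wa+wb) ⟩
    X + (wa + wb)    ≡⟨ cong (X +_) (+-comm wa wb) ⟩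
    X + (wb + wa)    ≡⟨ sym (+-assoc X wb wa) ⟩
    X + wb + wa      ≡⟨ cong (_+ wa) X+wb≡W ⟩
    W + wa           ≡⟨ +-comm W wa ⟩
    wa + W           ∎)
    where open ≡-Reasoning

  X≤wa : X ≤ wa
  X≤wa = subst (X ≤_) X+Y≡wa (m≤m+n X Y)

  Y≤wa : Y ≤ wa
  Y≤wa = subst (Y ≤_) X+Y≡wa (m≤n+m Y X)

  L : Bool → Bool → ℕ
  L sa sb = (sa ∧ not sb) · wa + (sb ∧ not sa) · wb + (sa ∧ sb) · W

  -- T_{a→S}: a′ weighs X and a weighs Y
  S-forward : ∀ sa sb → L sa sb ≤ sa · X + (sa ∧ not sb) · Y + sb · wb
  S-forward true  true  rewrite +-identityʳ X = ≤-reflexive (sym X+wb≡W)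
  S-forward true  false rewrite +-identityʳ wa | +-identityʳ wa | +-identityʳ (X + Y) =
    ≤-reflexive (sym X+Y≡wa)
  S-forward false true  = ≤-reflexive (+-identityʳ wb)
  S-forward false false = z≤n

  S-backward : ∀ ra rb z → ¬ (ra ≡ true × rb ≡ true) → z · X + ra · Y + rb · wb ≤ L (ra ∨ z) rb
  S-backward true  true  _     no-ab = contradiction (refl , refl) no-ab
  S-backward true  false true  _ rewrite +-identityʳ wa | +-identityʳ wa | +-identityʳ (X + Y) =
    ≤-reflexive X+Y≡wa
  S-backward true  false false _ rewrite +-identityʳ wa | +-identityʳ wa | +-identityʳ Y = Y≤wa
  S-backward false true  true  _ rewrite +-identityʳ X = ≤-reflexive X+wb≡W
  S-backward false true  false _ = ≤-reflexive (sym (+-identityʳ wb))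
  S-backward false false true  _ rewrite +-identityʳ wa | +-identityʳ wa | +-identityʳ X | +-identityʳ X =
    X≤wa
  S-backward false false false _ = z≤n

  -- T_{a→K}: a′ weighs X and a keeps its weight
  K-forward : ∀ sa sb → L sa sb ≤ (sa ∧ sb) · X + (sa ∧ not sb) · wa + sb · wb
  K-forward true  true  rewrite +-identityʳ X = ≤-reflexive (sym X+wb≡W)
  K-forward true  false rewrite +-identityʳ wa = ≤-reflexive (+-identityʳ wa)
  K-forward false true  = ≤-reflexive (+-identityʳ wb)
  K-forward false false = z≤n

  K-backward : ∀ ra rb z → ¬ (ra ≡ true × rb ≡ true) → ¬ (ra ≡ true × z ≡ true) →
    z · X + ra · wa + rb · wb ≤ L (ra ∨ z) rb
  K-backward true  true  _     no-ab _      = contradiction (refl , refl) no-ab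
  K-backward true  false true  _     no-aa′ = contradiction (refl , refl) no-aa′
  K-backward true  false false _     _ rewrite +-identityʳ wa = ≤-reflexive (sym (+-identityʳ wa))
  K-backward false true  true  _     _ rewrite +-identityʳ X = ≤-reflexive X+wb≡W
  K-backward false true  false _     _ = ≤-reflexive (sym (+-identityʳ wb))
  K-backward false false true  _     _ rewrite +-identityʳ wa | +-identityʳ wa | +-identityʳ X | +-identityʳ X =
    X≤wa
  K-backward false false false _     _ = z≤n

-- The four statements for T_{a→S} and T_{a→K}; those for b are the same with a, b exchanged.
module Operations {n : ℕ} (T : Trigraph n) (weighted : WeightedTrigraph T) (mono : Monogamous T)
                  (a b : Fin n) (a≢b : a ≢ b) (ab : θ T a b ≡ semi) where

  θ-sym : ∀ u v → θ T u v ≡ θ T v u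
  θ-sym = proj₁ weighted

  wp-sym : ∀ u v → wp T u v ≡ wp T v u
  wp-sym = proj₁ (proj₂ weighted)

  bounds : (w T a ⊔ w T b ≤ wp T a b) × (wp T a b ≤ w T a + w T b)
  bounds = proj₂ (proj₂ weighted) a b a≢b ab

  open LocalWeights (w T a) (w T b) (wp T a b)
         (≤-trans (m≤n⊔m (w T a) (w T b)) (proj₁ bounds)) (proj₂ bounds)

  N-K : Fin n → Bool
  N-K v = v ==F a ∨ inNa T a b v

  N-K-off-a : ∀ v → v ≢ a → N-K v ≡ inNa T a b v
  N-K-off-a v v≢a = cong (_∨ inNa T a b v) (==F-≢ v≢a)

  module OpS = SplitWeights T θ-sym wp-sym mono a b a≢b ab (inNa T a b) (λ _ _ → refl)
                 (w (toS T a b)) (λ v v≢a → cong (λ c → if c then _ else w T v) (==F-≢ v≢a))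
  module OpK = SplitWeights T θ-sym wp-sym mono a b a≢b ab N-K N-K-off-a (w (toK T a b)) (λ _ _ → refl)

  Berge-toS : Berge T → Berge (toS T a b)
  Berge-toS = Split.preserves-Berge T θ-sym mono a b a≢b ab (inNa T a b) (λ _ _ → refl)

  Berge-toK : Berge T → Berge (toK T a b)
  Berge-toK = Split.preserves-Berge T θ-sym mono a b a≢b ab N-K N-K-off-a

  -- (ii) for T_{a→S}: a stable set of T lifts with a′ present exactly when a is;
  -- a′ sees neither a nor b, and a now weighs Y
  α-toS : α (toS T a b) ≡ α T
  α-toS = ≤-antisym
    (OpS.α-T′≤α-T λ ra rb z no-ab _ →
      subst (λ y → z · X + ra · y + rb · w T b ≤ L (ra ∨ z) rb) (sym weight-a) (S-backward ra rb z no-ab))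
    (OpS.α-T≤α-T′ (λ sa _ → sa) covers (λ _ _ _ _ → a′-misses-a) λ sa sb →
      subst (λ y → L sa sb ≤ sa · X + (sa ∧ not sb) · y + sb · w T b) (sym weight-a) (S-forward sa sb))
    where
    weight-a : w (toS T a b) (suc a) ≡ Y
    weight-a = cong (λ c → if c then Y else w T a) (==F-refl a)
    covers : ∀ sa sb → sa ≡ (sa ∧ not sb) ∨ sa
    covers false _     = refl
    covers true  false = refl
    covers true  true  = refl
    a′-misses-a : θ (toS T a b) zero (suc a) ≢ strong
    a′-misses-a rewrite ==F-refl a = λ ()

  -- (ii) for T_{a→K}: a′ is added exactly when both a and b are present, so it never
  -- meets a (to which it is strongly adjacent)
  α-toK : α (toK T a b) ≡ α T
  α-toK = ≤-antisym
    (OpK.α-T′≤α-T λ ra rb z no-ab no-aa′ → K-backward ra rb z no-ab (no-aa′ a′-sees-a))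
    (OpK.α-T≤α-T′ (λ sa sb → sa ∧ sb) covers separated K-forward)
    where
    a′-sees-a : θ (toK T a b) zero (suc a) ≡ strong
    a′-sees-a rewrite ==F-refl a = refl
    covers : ∀ sa sb → sa ≡ (sa ∧ not sb) ∨ (sa ∧ sb)
    covers false _     = refl
    covers true  false = refl
    covers true  true  = refl
    separated : ∀ sa sb → sa ∧ sb ≡ true → sa ∧ not sb ≡ true → θ (toK T a b) zero (suc a) ≢ strong
    separated true true _ ()

lemma5p8 : ∀ {n} (T : Trigraph n) → WeightedTrigraph T → Monogamous T →
    (a b : Fin n) → a ≢ b → θ T a b ≡ semi →
    (Berge T →
      Berge (toS T a b) × Berge (toS T b a) × Berge (toK T a b) × Berge (toK T b a)) ×
    (α (toS T a b) ≡ α T × α (toS T b a) ≡ α T ×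
     α (toK T a b) ≡ α T × α (toK T b a) ≡ α T)
lemma5p8 T weighted mono a b a≢b ab =
  (λ berge → at-ab.Berge-toS berge , at-ba.Berge-toS berge , at-ab.Berge-toK berge , at-ba.Berge-toK berge) ,
  (at-ab.α-toS , at-ba.α-toS , at-ab.α-toK , at-ba.α-toK)
  where
  module at-ab = Operations T weighted mono a b a≢b ab
  module at-ba = Operations T weighted mono b a (a≢b ∘ sym) (trans (proj₁ weighted b a) ab)
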